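{- Let $U$ be a set with at least two elements and let $\pi,\sigma$ be partitions on $U$ with $\operatorname{dit}(\pi)\neq\emptyset$ and $\operatorname{dit}(\sigma)\neq\emptyset$. Then $\operatorname{dit}(\pi)\cap\operatorname{dit}(\sigma)\neq\emptyset$.
   Context: A partition on $U$ is a set of nonempty, pairwise disjoint subsets of $U$ (blocks) whose union is $U$. For a partition $\pi$, $\operatorname{dit}(\pi)\subseteq U\times U$ is the set of ordered pairs $(u,u')$ with $u,u'$ in different blocks of $\pi$. -}

module Defs where

open import Level using (0ℓ)
open import Data.Product using (_×_; _,_; ∃; ∃-syntax)
open import Relation.Binary.PropositionalEquality using (_≢_)
open import Relation.Unary using (Pred; _∈_; _∩_; Empty; Satisfiable)

record Partition (U : Set) : Set₁ where
  field
    Index    : Set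
    block    : Index → Pred U 0ℓ
    nonempty : ∀ i → Satisfiable (block i)
    disjoint : ∀ i j → i ≢ j → Empty (block i ∩ block j)
    cover    : ∀ u → ∃[ i ] (u ∈ block i)

open Partition public

dit : {U : Set} → Partition U → Pred (U × U) 0ℓ
dit π (u , u') = ∃[ i ] ∃[ j ] (i ≢ j × u ∈ block π i × u' ∈ block π j)

-- dit π is an apartness relation up to double negation: symmetric, and
-- cotransitive because the block of a third point either differs from the block
-- of u or from that of u'. For two such relations an inhabited pair of each
-- already forces a common pair, by at most three uses of cotransitivity.
-- Since the goal is a negation, reasoning under double negation costs nothing.
module Submission where

open import Defs
open import Level using (Level)
open import Data.Empty using (⊥)
open import Data.Product using (_×_; _,_; ∃₂; Σ-syntax; curry)
open import Data.Sum using (_⊎_; inj₁; inj₂)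
open import Relation.Binary.Core using (Rel)
open import Relation.Binary.Definitions using (Symmetric)
open import Relation.Binary.PropositionalEquality using (_≡_; _≢_; refl; sym)
open import Relation.Nullary using (¬_; Dec; yes; no)
open import Relation.Nullary.Negation using (¬¬-map)
open import Relation.Nullary.Decidable using (¬¬-excluded-middle)
open import Relation.Unary using (_∩_; Empty)

private
  variable
    a ℓ₁ ℓ₂ : Level
    A : Set a

WeaklyCotransitive : Rel A ℓ₁ → Set _
WeaklyCotransitive _#_ = ∀ {x y} → x # y → ∀ z → ¬ ¬ (x # z ⊎ z # y)

inhabited-apartnesses-overlap : {R : Rel A ℓ₁} {S : Rel A ℓ₂} →
  Symmetric R → WeaklyCotransitive R → WeaklyCotransitive S →
  ∀ {u v x y} → R u v → S x y → ¬ ¬ (∃₂ λ p q → R p q × S p q)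
inhabited-apartnesses-overlap {R = R} sym-R cotrans-R cotrans-S {x = x} {y = y} uRv xSy common =
  cotrans-R uRv x λ where
    (inj₁ uRx) → apart-from (sym-R uRx)
    (inj₂ xRv) → apart-from xRv
  where
  apart-from : ∀ {z} → R x z → ⊥
  apart-from {z} xRz = cotrans-S xSy z λ where
    (inj₁ xSz) → common (x , z , xRz , xSz)
    (inj₂ zSy) → cotrans-R xRz y λ where
      (inj₁ xRy) → common (x , y , xRy , xSy)
      (inj₂ yRz) → common (z , y , sym-R yRz , zSy)

module _ {U : Set} (π : Partition U) where

  dit-symmetric : Symmetric (curry (dit π))
  dit-symmetric (i , j , i≢j , u∈i , v∈j) = j , i , (λ j≡i → i≢j (sym j≡i)) , v∈j , u∈i

  dit-cotransitive : WeaklyCotransitive (curry (dit π))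
  dit-cotransitive {u} {v} (i , j , i≢j , u∈i , v∈j) w with cover π w
  ... | k , w∈k = ¬¬-map separate ¬¬-excluded-middle
    where
    separate : Dec (i ≡ k) → dit π (u , w) ⊎ dit π (w , v)
    separate (yes refl) = inj₂ (k , j , i≢j , w∈k , v∈j)
    separate (no i≢k)   = inj₁ (i , k , i≢k , u∈i , w∈k)

mainTheorem2 : (U : Set) → (Σ[ u ∈ U ] Σ[ v ∈ U ] (u ≢ v)) → (π σ : Partition U)
    → ¬ Empty (dit π) → ¬ Empty (dit σ) → ¬ Empty (dit π ∩ dit σ)
mainTheorem2 U _ π σ π-splits σ-splits no-common =
  π-splits λ { (u , v) uv∈π → σ-splits λ { (x , y) xy∈σ →
    inhabited-apartnesses-overlap (dit-symmetric π) (dit-cotransitive π) (dit-cotransitive σ) uv∈π xy∈σ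
      λ { (p , q , pq∈π , pq∈σ) → no-common (p , q) (pq∈π , pq∈σ) } } }
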